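{- Let $n,t$ be positive integers and $u=n-t$, and consider parameters with $u\ge10$, $t/u\to\infty$ and $u^2/t\to\infty$. (a) If $j_0$ is an index $j\in[0,u/2]$ at which $\binom tj(n-t-j)!$ is maximal, then $j_0=(1+o(1))\frac tu$. (b) There exists a constant $C>0$ such that (for all such parameters, sufficiently far along) $$\sum_{0\le j\le 0.1u}\binom tj(n-t-j)!\le C\sqrt{\frac tu}\cdot\max_{0\le j\le u}\binom tj(n-t-j)!.$$
   Context: The paper writes the hypotheses as $u^2\gg t\gg u$ and $u\ge10$, where $f\ll g$ means $f/g\to0$. -}

module Defs where

open import Data.Nat using (ℕ; zero; suc; _+_; _*_; _∸_; _⊔_; _!)
open import Data.Nat.Combinatorics using (_C_)

-- The term  binom(t, j) * (n - t - j)!  written with u = n - t.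
term : (t u j : ℕ) → ℕ
term t u j = (t C j) * ((u ∸ j) !)

sumUpTo : ℕ → (ℕ → ℕ) → ℕ
sumUpTo zero    f = f zero
sumUpTo (suc N) f = sumUpTo N f + f (suc N)

maxUpTo : ℕ → (ℕ → ℕ) → ℕ
maxUpTo zero    f = f zero
maxUpTo (suc N) f = maxUpTo N f ⊔ f (suc N)

{-# OPTIONS --safe #-}
-- The ratio term t u (j+1) / term t u j = (t − j) / ((j+1)(u − j)) decreases in j and crosses 1 near
-- j = t/u. Comparing a maximiser j₀ with its two neighbours gives t ≤ j₀u + j₀ + u and j₀u ≤ t + j₀²,
-- and j₀² ≪ t because j₀u ≤ 2t and t ≪ u².
-- For (b) let E = ⌊√(t/u)⌋ ≥ 1. The terms grow by the factor E/(E−1) up to some index p; beyond it the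
-- denominator (j+1)(u − j) grows by about u/2 per step, so after O(E) more steps they decay by the factor
-- E/(E+1). Two geometric sums and a plateau of O(E) terms bound the sum by O(E) · max, and u E² ≤ t.
module Submission where

open import Defs
open import Data.Nat using (ℕ; _+_; _*_; _∸_; _/_; _≤_; ∣_-_∣)
open import Data.Product using (_×_; Σ)
open import Data.Nat
open import Data.Nat.Properties
open import Data.Nat.Combinatorics
  using (_C_; nCk≡n!/k![n-k]!; k![n∸k]!∣n!; [n-k]*d[k+1]≡[k+1]*d[k]; [n-k]*[n-k-1]!≡[n-k]!)
open import Data.Nat.DivMod using (m/n*n≡m; m/n*n≤m)
open import Data.Nat.Tactic.RingSolver using (solve-∀)
open import Algebra.Properties.CommutativeSemigroup *-commutativeSemigroup
  using (x∙yz≈y∙xz; x∙yz≈yx∙z; xy∙z≈y∙xz; xy∙z≈xz∙y)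
open import Data.Product using (∃-syntax; _,_)
open import Data.Sum using (inj₁; inj₂; [_,_]′)
open import Data.Empty using (⊥-elim)
open import Relation.Nullary using (¬_; yes; no)
open import Relation.Unary using (Decidable)
open import Relation.Binary.PropositionalEquality using (_≡_; refl; sym; trans; cong; cong₂; subst; module ≡-Reasoning)

nCk*k!*[n∸k]!≡n! : ∀ {n k} → k ≤ n → (n C k) * (k ! * (n ∸ k) !) ≡ n !
nCk*k!*[n∸k]!≡n! {n} {k} k≤n = begin
  (n C k) * d  ≡⟨ cong (_* d) (nCk≡n!/k![n-k]! k≤n) ⟩
  n ! / d * d  ≡⟨ m/n*n≡m (k![n∸k]!∣n! k≤n) ⟩
  n !          ∎
  where
  open ≡-Reasoning
  d : ℕ
  d = k ! * (n ∸ k) !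
  instance
    d≢0 : NonZero d
    d≢0 = k !* (n ∸ k) !≢0

nCk≢0 : ∀ {n k} → k ≤ n → NonZero (n C k)
nCk≢0 {n} {k} k≤n = m*n≢0⇒m≢0 (n C k) {{subst NonZero (sym (nCk*k!*[n∸k]!≡n! k≤n)) (n !≢0)}}

nC[1+k]*[1+k]≡nCk*[n∸k] : ∀ {n k} → k < n → (n C suc k) * suc k ≡ (n C k) * (n ∸ k)
nC[1+k]*[1+k]≡nCk*[n∸k] {n} {k} k<n = *-cancelʳ-≡ _ _ d {{k !* (n ∸ k) !≢0}} (begin
  (n C suc k) * suc k * d       ≡⟨ *-assoc (n C suc k) (suc k) d ⟩
  (n C suc k) * (suc k * d)     ≡⟨ cong ((n C suc k) *_) ([n-k]*d[k+1]≡[k+1]*d[k] k<n) ⟨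
  (n C suc k) * ((n ∸ k) * d′)  ≡⟨ x∙yz≈y∙xz (n C suc k) (n ∸ k) d′ ⟩
  (n ∸ k) * ((n C suc k) * d′)  ≡⟨ cong ((n ∸ k) *_) (nCk*k!*[n∸k]!≡n! k<n) ⟩
  (n ∸ k) * n !                 ≡⟨ cong ((n ∸ k) *_) (nCk*k!*[n∸k]!≡n! (<⇒≤ k<n)) ⟨
  (n ∸ k) * ((n C k) * d)       ≡⟨ x∙yz≈yx∙z (n ∸ k) (n C k) d ⟩
  (n C k) * (n ∸ k) * d         ∎)
  where
  open ≡-Reasoning
  d d′ : ℕ
  d  = k ! * (n ∸ k) !
  d′ = suc k ! * (n ∸ suc k) !

-- term t u (suc j) / term t u j = (t ∸ j) / den u j
den : ℕ → ℕ → ℕ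
den u j = suc j * (u ∸ j)

den≢0 : ∀ {u j} → j < u → NonZero (den u j)
den≢0 {u} {j} j<u = m*n≢0 (suc j) (u ∸ j) {{_}} {{≢-nonZero (m>n⇒m∸n≢0 j<u)}}

term≢0 : ∀ {t u j} → j ≤ t → NonZero (term t u j)
term≢0 {t} {u} {j} j≤t = m*n≢0 (t C j) ((u ∸ j) !) {{nCk≢0 j≤t}} {{(u ∸ j) !≢0}}

term-suc : ∀ {t u j} → j < t → j < u → term t u (suc j) * den u j ≡ term t u j * (t ∸ j)
term-suc {t} {u} {j} j<t j<u = begin
  (t C suc j) * (u ∸ suc j) ! * (suc j * (u ∸ j))  ≡⟨ regroup (t C suc j) ((u ∸ suc j) !) (suc j) (u ∸ j) ⟩
  (t C suc j) * suc j * ((u ∸ j) * (u ∸ suc j) !)  ≡⟨ cong₂ _*_ (nC[1+k]*[1+k]≡nCk*[n∸k] j<t) ([n-k]*[n-k-1]!≡[n-k]! j<u) ⟩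
  (t C j) * (t ∸ j) * (u ∸ j) !                    ≡⟨ xy∙z≈xz∙y (t C j) (t ∸ j) ((u ∸ j) !) ⟩
  (t C j) * (u ∸ j) ! * (t ∸ j)                    ∎
  where
  open ≡-Reasoning
  regroup : ∀ c f a b → c * f * (a * b) ≡ c * a * (b * f)
  regroup = solve-∀

module _ {X X′ f g : ℕ} (X′f≡Xg : X′ * f ≡ X * g) where
  open ≤-Reasoning

  proportion-lower : ∀ a b .{{_ : NonZero f}} → a * f ≤ b * g → a * X ≤ b * X′
  proportion-lower a b af≤bg = *-cancelʳ-≤ (a * X) (b * X′) f (begin
    a * X * f     ≡⟨ xy∙z≈y∙xz a X f ⟩
    X * (a * f)   ≤⟨ *-monoʳ-≤ X af≤bg ⟩
    X * (b * g)   ≡⟨ x∙yz≈y∙xz X b g ⟩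
    b * (X * g)   ≡⟨ cong (b *_) X′f≡Xg ⟨
    b * (X′ * f)  ≡⟨ *-assoc b X′ f ⟨
    b * X′ * f    ∎)

  proportion-upper : ∀ a b .{{_ : NonZero f}} → a * g ≤ b * f → a * X′ ≤ b * X
  proportion-upper a b ag≤bf = *-cancelʳ-≤ (a * X′) (b * X) f (begin
    a * X′ * f    ≡⟨ *-assoc a X′ f ⟩
    a * (X′ * f)  ≡⟨ cong (a *_) X′f≡Xg ⟩
    a * (X * g)   ≡⟨ x∙yz≈y∙xz a X g ⟩
    X * (a * g)   ≤⟨ *-monoʳ-≤ X ag≤bf ⟩
    X * (b * f)   ≡⟨ xy∙z≈y∙xz b X f ⟨
    b * X * f     ∎)

  proportion-lower⁻¹ : .{{_ : NonZero X}} → X ≤ X′ → f ≤ g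
  proportion-lower⁻¹ X≤X′ = *-cancelˡ-≤ X (begin
    X * f   ≤⟨ *-monoˡ-≤ f X≤X′ ⟩
    X′ * f  ≡⟨ X′f≡Xg ⟩
    X * g   ∎)

  proportion-upper⁻¹ : .{{_ : NonZero X}} → X′ ≤ X → g ≤ f
  proportion-upper⁻¹ X′≤X = *-cancelˡ-≤ X (begin
    X * g   ≡⟨ X′f≡Xg ⟨
    X′ * f  ≤⟨ *-monoˡ-≤ f X′≤X ⟩
    X * f   ∎)

module _ {t u j : ℕ} (j<t : j < t) (j<u : j < u) where
  private
    instance
      den≢0′ : NonZero (den u j)
      den≢0′ = den≢0 j<u
      term≢0′ : NonZero (term t u j)
      term≢0′ = term≢0 (<⇒≤ j<t)

    step : term t u (suc j) * den u j ≡ term t u j * (t ∸ j)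
    step = term-suc j<t j<u

  term-rises-by : ∀ a b → a * den u j ≤ b * (t ∸ j) → a * term t u j ≤ b * term t u (suc j)
  term-rises-by a b = proportion-lower {f = den u j} {g = t ∸ j} step a b

  term-falls-by : ∀ a b → a * (t ∸ j) ≤ b * den u j → a * term t u (suc j) ≤ b * term t u j
  term-falls-by a b = proportion-upper {f = den u j} {g = t ∸ j} step a b

  term-rises⇒den≤t∸j : term t u j ≤ term t u (suc j) → den u j ≤ t ∸ j
  term-rises⇒den≤t∸j rises = proportion-lower⁻¹ {X = term t u j} {X′ = term t u (suc j)} step rises

  term-falls⇒t∸j≤den : term t u (suc j) ≤ term t u j → t ∸ j ≤ den u j
  term-falls⇒t∸j≤den falls = proportion-upper⁻¹ {X = term t u j} {X′ = term t u (suc j)} step falls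

≤-maxUpTo : ∀ (x : ℕ → ℕ) {N j} → j ≤ N → x j ≤ maxUpTo N x
≤-maxUpTo x {zero}  z≤n    = ≤-refl
≤-maxUpTo x {suc N} j≤1+N with m≤n⇒m<n∨m≡n j≤1+N
... | inj₁ j<1+N = ≤-trans (≤-maxUpTo x (m<1+n⇒m≤n j<1+N)) (m≤m⊔n _ _)
... | inj₂ refl  = m≤n⊔m _ _

module _ (x : ℕ → ℕ) (e : ℕ) where
  open ≤-Reasoning

  sumUpTo-rising : ∀ N → (∀ {j} → j < N → suc e * x j ≤ e * x (suc j)) → sumUpTo N x ≤ suc e * x N
  sumUpTo-rising zero    _     = m≤m+n (x 0) (e * x 0)
  sumUpTo-rising (suc N) rises = begin
    sumUpTo N x + x (suc N)    ≤⟨ +-monoˡ-≤ _ (sumUpTo-rising N (λ j<N → rises (m<n⇒m<1+n j<N))) ⟩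
    suc e * x N + x (suc N)    ≤⟨ +-monoˡ-≤ _ (rises (n<1+n N)) ⟩
    e * x (suc N) + x (suc N)  ≡⟨ +-comm (e * x (suc N)) (x (suc N)) ⟩
    suc e * x (suc N)          ∎

  sumUpTo-falling : ∀ {q N} → q ≤ N → (∀ {j} → q ≤ j → j < N → suc (suc e) * x (suc j) ≤ suc e * x j) →
                    sumUpTo N x + suc e * x N ≤ sumUpTo q x + suc e * x q
  sumUpTo-falling {N = zero}  z≤n   _     = ≤-refl
  sumUpTo-falling {q} {suc N} q≤1+N falls with m≤n⇒m<n∨m≡n q≤1+N
  ... | inj₂ refl  = ≤-refl
  ... | inj₁ q<1+N = begin
    sumUpTo N x + x (suc N) + suc e * x (suc N)  ≡⟨ +-assoc (sumUpTo N x) (x (suc N)) _ ⟩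
    sumUpTo N x + suc (suc e) * x (suc N)        ≤⟨ +-monoʳ-≤ (sumUpTo N x) (falls q≤N (n<1+n N)) ⟩
    sumUpTo N x + suc e * x N                    ≤⟨ sumUpTo-falling q≤N (λ q≤j j<N → falls q≤j (m<n⇒m<1+n j<N)) ⟩
    sumUpTo q x + suc e * x q                    ∎
    where
    q≤N : q ≤ N
    q≤N = m<1+n⇒m≤n q<1+N

  sumUpTo-bounded : ∀ {M q N} → q ≤ N → (∀ {j} → j ≤ N → x j ≤ M) → sumUpTo N x ≤ sumUpTo q x + (N ∸ q) * M
  sumUpTo-bounded {N = zero}      z≤n   _       = m≤m+n _ _
  sumUpTo-bounded {M} {q} {suc N} q≤1+N bounded with m≤n⇒m<n∨m≡n q≤1+N
  ... | inj₂ refl  = m≤m+n _ _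
  ... | inj₁ q<1+N = begin
    sumUpTo N x + x (suc N)                    ≤⟨ +-mono-≤ (sumUpTo-bounded q≤N (λ j≤N → bounded (m≤n⇒m≤1+n j≤N))) (bounded ≤-refl) ⟩
    sumUpTo q x + (N ∸ q) * M + M              ≡⟨ +-assoc (sumUpTo q x) _ M ⟩
    sumUpTo q x + ((N ∸ q) * M + M)            ≡⟨ cong (sumUpTo q x +_) (+-comm ((N ∸ q) * M) M) ⟩
    sumUpTo q x + suc (N ∸ q) * M              ≡⟨ cong (λ k → sumUpTo q x + k * M) (+-∸-assoc 1 q≤N) ⟨
    sumUpTo q x + (suc N ∸ q) * M              ∎
    where
    q≤N : q ≤ N
    q≤N = m<1+n⇒m≤n q<1+N

  -- Each geometric stretch contributes at most (e+1) M, the W terms between them at most W M.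
  sumUpTo-rise-plateau-fall : ∀ {M U} p W → p ≤ U → (∀ {j} → j ≤ U → x j ≤ M) →
    (∀ {j} → j < p → suc e * x j ≤ e * x (suc j)) →
    (∀ {j} → W + p ≤ j → j < U → suc (suc e) * x (suc j) ≤ suc e * x j) →
    sumUpTo U x ≤ (2 * suc e + W) * M
  sumUpTo-rise-plateau-fall {M} {U} p W p≤U bounded rises falls = begin
    sumUpTo U x                  ≤⟨ past-peak ⟩
    sumUpTo p x + W * M + E * M  ≤⟨ +-monoˡ-≤ (E * M) (+-monoˡ-≤ (W * M) up-to-p) ⟩
    E * M + W * M + E * M        ≡⟨ collect E W M ⟩
    (2 * E + W) * M              ∎
    where
    E : ℕ
    E = suc e
    collect : ∀ E W M → E * M + W * M + E * M ≡ (2 * E + W) * M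
    collect = solve-∀
    up-to-p : sumUpTo p x ≤ E * M
    up-to-p = ≤-trans (sumUpTo-rising p rises) (*-monoʳ-≤ E (bounded p≤U))
    past-peak : sumUpTo U x ≤ sumUpTo p x + W * M + E * M
    past-peak with W + p ≤? U
    ... | no  W+p≰U = begin
      sumUpTo U x                  ≤⟨ sumUpTo-bounded p≤U bounded ⟩
      sumUpTo p x + (U ∸ p) * M    ≤⟨ +-monoʳ-≤ (sumUpTo p x) (*-monoˡ-≤ M U∸p≤W) ⟩
      sumUpTo p x + W * M          ≤⟨ m≤m+n _ (E * M) ⟩
      sumUpTo p x + W * M + E * M  ∎
      where
      U∸p≤W : U ∸ p ≤ W
      U∸p≤W = m≤n+o⇒m∸n≤o U p (subst (U ≤_) (+-comm W p) (<⇒≤ (≰⇒> W+p≰U)))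
    ... | yes W+p≤U = begin
      sumUpTo U x                                ≤⟨ m≤m+n _ (E * x U) ⟩
      sumUpTo U x + E * x U                      ≤⟨ sumUpTo-falling W+p≤U falls ⟩
      sumUpTo (W + p) x + E * x (W + p)          ≤⟨ +-mono-≤ (sumUpTo-bounded (m≤n+m p W) (λ j≤W+p → bounded (≤-trans j≤W+p W+p≤U)))
                                                             (*-monoʳ-≤ E (bounded W+p≤U)) ⟩
      sumUpTo p x + (W + p ∸ p) * M + E * M      ≡⟨ cong (λ k → sumUpTo p x + k * M + E * M) (m+n∸n≡m W p) ⟩
      sumUpTo p x + W * M + E * M                ∎

least-failure : ∀ {P : ℕ → Set} → Decidable P → ∀ U →
                ∃[ p ] p ≤ U × (∀ {j} → j < p → P j) × (p < U → ¬ P p)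
least-failure P? zero = 0 , z≤n , (λ ()) , (λ ())
least-failure P? (suc U) with least-failure P? U
... | p , p≤U , below , fails with m≤n⇒m<n∨m≡n p≤U
...   | inj₁ p<U = p , m≤n⇒m≤1+n p≤U , below , (λ _ → fails p<U)
...   | inj₂ refl with P? p
...     | yes Pp = suc p , ≤-refl , (λ j<1+p → [ below , (λ { refl → Pp }) ]′ (m<1+n⇒m<n∨m≡n j<1+p))
                         , (λ p<p → ⊥-elim (<-irrefl refl p<p))
...     | no ¬Pp = p , n≤1+n p , below , (λ _ → ¬Pp)

sqrt-bracket : ∀ t u .{{_ : NonZero u}} → ∃[ E ] u * (E * E) ≤ t × t < u * (suc E * suc E)
sqrt-bracket zero    (suc u) = 0 , ≤-reflexive (*-zeroʳ u) , z<s
sqrt-bracket (suc t) u with sqrt-bracket t u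
... | E , uE²≤t , t<u[1+E]² with u * (suc E * suc E) ≤? suc t
...   | no  u[1+E]²≰1+t = E , m≤n⇒m≤1+n uE²≤t , ≰⇒> u[1+E]²≰1+t
...   | yes u[1+E]²≤1+t = suc E , u[1+E]²≤1+t , (begin-strict
  suc t                          ≤⟨ t<u[1+E]² ⟩
  u * (suc E * suc E)            <⟨ *-monoʳ-< u (*-mono-< (n<1+n (suc E)) (n<1+n (suc E))) ⟩
  u * (suc (suc E) * suc (suc E))  ∎)
  where open ≤-Reasoning

-- den u j − den u p = (j − p)(u − p − j − 1), which is at least (j − p) u / 2 while p + j < u / 2.
den-gap : ∀ {u p j} → p ≤ j → 2 * suc (p + j) ≤ u → 2 * den u p + (j ∸ p) * u ≤ 2 * den u j
den-gap {u} {p} {j} p≤j 2[1+p+j]≤u with m≤n⇒∃[o]m+o≡n p≤j | m≤n⇒∃[o]m+o≡n j≤u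
  where
  j≤u : j ≤ u
  j≤u = ≤-trans (≤-trans (m≤n+m j p) (n≤1+n (p + j))) (≤-trans (m≤n*m (suc (p + j)) 2) 2[1+p+j]≤u)
... | d , refl | r , refl = begin
  2 * (suc p * (p + d + r ∸ p)) + (p + d ∸ p) * (p + d + r)
    ≡⟨ cong₂ (λ a b → 2 * (suc p * a) + b * (p + d + r)) (trans (cong (_∸ p) (+-assoc p d r)) (m+n∸m≡n p (d + r))) (m+n∸m≡n p d) ⟩
  2 * (suc p * (d + r)) + d * (p + d + r)   ≡⟨ expand p d r ⟩
  2 * suc p * r + d * (p + d + r + 2 * suc p) ≤⟨ +-monoʳ-≤ (2 * suc p * r) (*-monoʳ-≤ d room) ⟩
  2 * suc p * r + d * (r + r)               ≡⟨ collect p d r ⟩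
  2 * (suc (p + d) * r)                     ≡⟨ cong (λ a → 2 * (suc (p + d) * a)) (m+n∸m≡n (p + d) r) ⟨
  2 * (suc (p + d) * (p + d + r ∸ (p + d))) ∎
  where
  open ≤-Reasoning
  expand : ∀ p d r → 2 * (suc p * (d + r)) + d * (p + d + r) ≡ 2 * suc p * r + d * (p + d + r + 2 * suc p)
  expand = solve-∀
  collect : ∀ p d r → 2 * suc p * r + d * (r + r) ≡ 2 * (suc (p + d) * r)
  collect = solve-∀
  shift : ∀ p d r → p + d + r + 2 * suc p + (p + d) ≡ r + 2 * suc (p + (p + d))
  shift = solve-∀
  unshift : ∀ p d r → r + (p + d + r) ≡ r + r + (p + d)
  unshift = solve-∀
  room : p + d + r + 2 * suc p ≤ r + r
  room = +-cancelʳ-≤ (p + d) _ _ (begin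
    p + d + r + 2 * suc p + (p + d)  ≡⟨ shift p d r ⟩
    r + 2 * suc (p + (p + d))        ≤⟨ +-monoʳ-≤ r 2[1+p+j]≤u ⟩
    r + (p + d + r)                  ≡⟨ unshift p d r ⟩
    r + r + (p + d)                  ∎)

-- Once (t ∸ p) / den u p has dropped below (e+1)/e, the ratio is below (e+1)/(e+2) after 16(e+1)+2 more
-- steps: t ≤ 4(e+1)² u bounds the gap between the two thresholds, and den grows by u/2 per step.
falls-beyond : ∀ {t u p j} e → t ≤ 4 * (suc e * suc e) * u → e * (t ∸ p) ≤ suc e * den u p → p ≤ u →
               16 * suc e + 2 + p ≤ j → 2 * suc (p + j) ≤ u → suc (suc e) * (t ∸ j) ≤ suc e * den u j
falls-beyond {t} {u} {p} {j} e t≤4E²u e[t∸p]≤E*den p≤u W+p≤j 2[1+p+j]≤u = *-cancelˡ-≤ 2 (begin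
  2 * (suc E * (t ∸ j))                              ≤⟨ *-monoʳ-≤ 2 (*-monoʳ-≤ (suc E) (m∸n≤m t j)) ⟩
  2 * (suc E * t)                                    ≡⟨ split e t ⟩
  2 * (e * t) + 4 * t                                ≤⟨ +-mono-≤ (*-monoʳ-≤ 2 et≤) (*-monoʳ-≤ 4 t≤4E²u) ⟩
  2 * (E * u + e * (t ∸ p)) + 4 * (4 * (E * E) * u)  ≤⟨ +-monoˡ-≤ _ (*-monoʳ-≤ 2 (+-monoʳ-≤ (E * u) e[t∸p]≤E*den)) ⟩
  2 * (E * u + E * den u p) + 4 * (4 * (E * E) * u)  ≡⟨ factor E u (den u p) ⟩
  E * (2 * den u p + W * u)                          ≤⟨ *-monoʳ-≤ E (+-monoʳ-≤ (2 * den u p) (*-monoˡ-≤ u W≤j∸p)) ⟩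
  E * (2 * den u p + (j ∸ p) * u)                    ≤⟨ *-monoʳ-≤ E (den-gap p≤j 2[1+p+j]≤u) ⟩
  E * (2 * den u j)                                  ≡⟨ x∙yz≈y∙xz E 2 (den u j) ⟩
  2 * (E * den u j)                                  ∎)
  where
  open ≤-Reasoning
  E W : ℕ
  E = suc e
  W = 16 * E + 2
  split : ∀ e t → 2 * (suc (suc e) * t) ≡ 2 * (e * t) + 4 * t
  split = solve-∀
  factor : ∀ E u f → 2 * (E * u + E * f) + 4 * (4 * (E * E) * u) ≡ E * (2 * f + (16 * E + 2) * u)
  factor = solve-∀
  p≤j : p ≤ j
  p≤j = ≤-trans (m≤n+m p W) W+p≤j
  W≤j∸p : W ≤ j ∸ p
  W≤j∸p = m+n≤o⇒m≤o∸n W W+p≤j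
  et≤ : e * t ≤ E * u + e * (t ∸ p)
  et≤ = begin
    e * t                ≤⟨ *-monoʳ-≤ e (m≤n+m∸n t p) ⟩
    e * (p + (t ∸ p))    ≡⟨ *-distribˡ-+ e p (t ∸ p) ⟩
    e * p + e * (t ∸ p)  ≤⟨ +-monoˡ-≤ (e * (t ∸ p)) (*-mono-≤ (n≤1+n e) p≤u) ⟩
    E * u + e * (t ∸ p)  ∎

sumUpTo-term≤ : ∀ {t u U} e → 4 * U ≤ u → u ≤ t → t ≤ 4 * (suc e * suc e) * u →
                sumUpTo U (term t u) ≤ (2 * suc e + (16 * suc e + 2)) * maxUpTo u (term t u)
sumUpTo-term≤ {t} {u} {U} e 4U≤u u≤t t≤4E²u =
  from-first-failure (least-failure (λ j → E * den u j ≤? e * (t ∸ j)) U)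
  where
  E W : ℕ
  E = suc e
  W = 16 * E + 2
  x : ℕ → ℕ
  x = term t u
  rises-at : ℕ → Set
  rises-at j = E * den u j ≤ e * (t ∸ j)
  U≤u : U ≤ u
  U≤u = ≤-trans (m≤n*m U 4) 4U≤u
  j<u : ∀ {j} → j < U → j < u
  j<u j<U = <-≤-trans j<U U≤u
  j<t : ∀ {j} → j < U → j < t
  j<t j<U = <-≤-trans (j<u j<U) u≤t
  double : ∀ U → 4 * U ≡ 2 * (U + U)
  double = solve-∀

  from-first-failure : ∃[ p ] p ≤ U × (∀ {j} → j < p → rises-at j) × (p < U → ¬ rises-at p) →
                       sumUpTo U x ≤ (2 * E + W) * maxUpTo u x
  from-first-failure (p , p≤U , below , fails) =
    sumUpTo-rise-plateau-fall x e p W p≤U (λ j≤U → ≤-maxUpTo x (≤-trans j≤U U≤u)) rises falls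
    where
    rises : ∀ {j} → j < p → E * x j ≤ e * x (suc j)
    rises {j} j<p = term-rises-by (j<t j<U) (j<u j<U) E e (below j<p)
      where
      j<U : j < U
      j<U = <-≤-trans j<p p≤U
    falls : ∀ {j} → W + p ≤ j → j < U → suc E * x (suc j) ≤ E * x j
    falls {j} W+p≤j j<U = term-falls-by (j<t j<U) (j<u j<U) (suc E) E
      (falls-beyond e t≤4E²u (<⇒≤ (≰⇒> (fails p<U))) (<⇒≤ (j<u p<U)) W+p≤j 2[1+p+j]≤u)
      where
      p<U : p < U
      p<U = ≤-<-trans (≤-trans (m≤n+m p W) W+p≤j) j<U
      2[1+p+j]≤u : 2 * suc (p + j) ≤ u
      2[1+p+j]≤u = ≤-trans (*-monoʳ-≤ 2 (subst (_≤ U + U) (+-suc p j) (+-mono-≤ (<⇒≤ p<U) j<U)))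
                           (subst (_≤ u) (double U) 4U≤u)

sum-squared-bound : ∀ {u t} → 1 ≤ u → u ≤ t →
  u * (sumUpTo (u / 10) (term t u) * sumUpTo (u / 10) (term t u))
    ≤ 20 * 20 * t * (maxUpTo u (term t u) * maxUpTo u (term t u))
sum-squared-bound {u} {t} 1≤u u≤t with sqrt-bracket t u {{>-nonZero 1≤u}}
... | zero  , _     , t<u*1      = ⊥-elim (<⇒≱ t<u*1 (subst (_≤ t) (sym (*-identityʳ u)) u≤t))
... | suc e , uE²≤t , t<u[1+E]² = begin
  u * (S * S)                        ≤⟨ *-monoʳ-≤ u (*-mono-≤ S≤20EM S≤20EM) ⟩
  u * (20 * E * M * (20 * E * M))    ≡⟨ regroup u E M ⟩
  20 * 20 * (u * (E * E)) * (M * M)  ≤⟨ *-monoˡ-≤ (M * M) (*-monoʳ-≤ (20 * 20) uE²≤t) ⟩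
  20 * 20 * t * (M * M)              ∎
  where
  open ≤-Reasoning
  E S M : ℕ
  E = suc e
  S = sumUpTo (u / 10) (term t u)
  M = maxUpTo u (term t u)
  regroup : ∀ u E M → u * (20 * E * M * (20 * E * M)) ≡ 20 * 20 * (u * (E * E)) * (M * M)
  regroup = solve-∀
  quadruple : ∀ u E → u * ((E + E) * (E + E)) ≡ 4 * (E * E) * u
  quadruple = solve-∀
  widths : ∀ e → 2 * suc e + (16 * suc e + 2) + 2 * e ≡ 20 * suc e
  widths = solve-∀
  4U≤u : 4 * (u / 10) ≤ u
  4U≤u = ≤-trans (≤-trans (*-monoˡ-≤ (u / 10) (m≤m+n 4 6)) (≤-reflexive (*-comm 10 (u / 10)))) (m/n*n≤m u 10)
  1+E≤E+E : suc E ≤ E + E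
  1+E≤E+E = +-monoˡ-≤ E (s≤s z≤n)
  t≤4E²u : t ≤ 4 * (E * E) * u
  t≤4E²u = begin
    t                        ≤⟨ <⇒≤ t<u[1+E]² ⟩
    u * (suc E * suc E)      ≤⟨ *-monoʳ-≤ u (*-mono-≤ 1+E≤E+E 1+E≤E+E) ⟩
    u * ((E + E) * (E + E))  ≡⟨ quadruple u E ⟩
    4 * (E * E) * u          ∎
  S≤20EM : S ≤ 20 * E * M
  S≤20EM = ≤-trans (sumUpTo-term≤ {U = u / 10} e 4U≤u u≤t t≤4E²u)
                   (*-monoˡ-≤ M (≤-trans (m≤m+n (2 * E + (16 * E + 2)) (2 * e)) (≤-reflexive (widths e))))

t∸j≤den⇒t≤j*u+[j+u] : ∀ {t u j} → t ∸ j ≤ den u j → t ≤ j * u + (j + u)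
t∸j≤den⇒t≤j*u+[j+u] {t} {u} {j} t∸j≤den = begin
  t                    ≤⟨ m≤n+m∸n t j ⟩
  j + (t ∸ j)          ≤⟨ +-monoʳ-≤ j t∸j≤den ⟩
  j + suc j * (u ∸ j)  ≤⟨ +-monoʳ-≤ j (*-monoʳ-≤ (suc j) (m∸n≤m u j)) ⟩
  j + suc j * u        ≡⟨ regroup j u ⟩
  j * u + (j + u)      ∎
  where
  open ≤-Reasoning
  regroup : ∀ j u → j + suc j * u ≡ j * u + (j + u)
  regroup = solve-∀

den≤t⇒[1+i]*u≤t+[1+i]*i : ∀ {t u i} → i ≤ u → den u i ≤ t → suc i * u ≤ t + suc i * i
den≤t⇒[1+i]*u≤t+[1+i]*i {t} {u} {i} i≤u den≤t = begin
  suc i * u               ≡⟨ cong (suc i *_) (m+[n∸m]≡n i≤u) ⟨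
  suc i * (i + (u ∸ i))   ≡⟨ *-distribˡ-+ (suc i) i (u ∸ i) ⟩
  suc i * i + den u i     ≤⟨ +-monoʳ-≤ (suc i * i) den≤t ⟩
  suc i * i + t           ≡⟨ +-comm (suc i * i) t ⟩
  t + suc i * i           ∎
  where open ≤-Reasoning

den≤t⇒[1+i]*u≤2*t : ∀ {t u i} → 2 * i ≤ u → den u i ≤ t → suc i * u ≤ 2 * t
den≤t⇒[1+i]*u≤2*t {t} {u} {i} 2i≤u den≤t = begin
  suc i * u                ≤⟨ *-monoʳ-≤ (suc i) u≤2[u∸i] ⟩
  suc i * (2 * (u ∸ i))    ≡⟨ x∙yz≈y∙xz (suc i) 2 (u ∸ i) ⟩
  2 * den u i              ≤⟨ *-monoʳ-≤ 2 den≤t ⟩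
  2 * t                    ∎
  where
  open ≤-Reasoning
  i+i≤u : i + i ≤ u
  i+i≤u = subst (_≤ u) (cong (i +_) (+-identityʳ i)) 2i≤u
  u≤2[u∸i] : u ≤ 2 * (u ∸ i)
  u≤2[u∸i] = begin
    u                      ≡⟨ m+[n∸m]≡n (m+n≤o⇒m≤o i i+i≤u) ⟨
    i + (u ∸ i)            ≤⟨ +-monoˡ-≤ (u ∸ i) (m+n≤o⇒m≤o∸n i i+i≤u) ⟩
    (u ∸ i) + (u ∸ i)      ≡⟨ cong ((u ∸ i) +_) (+-identityʳ (u ∸ i)) ⟨
    2 * (u ∸ i)            ∎

j*u≤2*t⇒k*j²≤t : ∀ {k t u j} .{{_ : NonZero t}} → 4 * k * t ≤ u * u → j * u ≤ 2 * t → k * (j * j) ≤ t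
j*u≤2*t⇒k*j²≤t {k} {t} {u} {j} 4kt≤u² ju≤2t = *-cancelˡ-≤ (4 * t) {{m*n≢0 4 t}} (begin
  4 * t * (k * (j * j))  ≡⟨ regroup k t j ⟩
  4 * k * t * (j * j)    ≤⟨ *-monoˡ-≤ (j * j) 4kt≤u² ⟩
  u * u * (j * j)        ≡⟨ interleave u j ⟩
  j * u * (j * u)        ≤⟨ *-mono-≤ ju≤2t ju≤2t ⟩
  2 * t * (2 * t)        ≡⟨ regroup′ t ⟩
  4 * t * t              ∎)
  where
  open ≤-Reasoning
  regroup : ∀ k t j → 4 * t * (k * (j * j)) ≡ 4 * k * t * (j * j)
  regroup = solve-∀
  interleave : ∀ u j → u * u * (j * j) ≡ j * u * (j * u)
  interleave = solve-∀
  regroup′ : ∀ t → 2 * t * (2 * t) ≡ 4 * t * t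
  regroup′ = solve-∀

u<2[1+j]⇒t≤j*u : ∀ {k t u j} → 1 ≤ k → 1 ≤ j → 4 * k * t ≤ u * u → u < 2 * suc j → t ≤ j * u
u<2[1+j]⇒t≤j*u {k} {t} {u} {j} 1≤k 1≤j 4kt≤u² u<2[1+j] = *-cancelˡ-≤ 4 (begin
  4 * t                      ≤⟨ *-monoˡ-≤ t (*-monoʳ-≤ 4 1≤k) ⟩
  4 * k * t                  ≤⟨ 4kt≤u² ⟩
  u * u                      ≤⟨ *-monoˡ-≤ u u≤2j+1 ⟩
  (2 * j + 1) * u            ≡⟨ expand j u ⟩
  2 * (j * u) + u            ≤⟨ +-monoʳ-≤ (2 * (j * u)) u≤2ju ⟩
  2 * (j * u) + 2 * (j * u)  ≡⟨ collect (j * u) ⟩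
  4 * (j * u)                ∎)
  where
  open ≤-Reasoning
  shift : ∀ j → 2 * suc j ≡ suc (2 * j + 1)
  shift = solve-∀
  expand : ∀ j u → (2 * j + 1) * u ≡ 2 * (j * u) + u
  expand = solve-∀
  collect : ∀ a → 2 * a + 2 * a ≡ 4 * a
  collect = solve-∀
  u≤2j+1 : u ≤ 2 * j + 1
  u≤2j+1 = s≤s⁻¹ (subst (suc u ≤_) (shift j) u<2[1+j])
  u≤2ju : u ≤ 2 * (j * u)
  u≤2ju = ≤-trans (subst (_≤ j * u) (+-identityʳ u) (*-monoˡ-≤ u 1≤j)) (m≤n*m (j * u) 2)

module _ {k t u : ℕ} (1≤k : 1 ≤ k) (2≤u : 2 ≤ u) (4ku≤t : 4 * k * u ≤ t) (4kt≤u² : 4 * k * t ≤ u * u) where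
  private
    u<t : u < t
    u<t = <-≤-trans (m<m*n u 4 {{>-nonZero (≤-trans (s≤s z≤n) 2≤u)}} (s≤s (s≤s z≤n)))
                    (subst (_≤ t) (*-comm 4 u) (≤-trans (*-monoˡ-≤ u (*-monoʳ-≤ 4 1≤k)) 4ku≤t))

    instance
      t≢0 : NonZero t
      t≢0 = >-nonZero (≤-<-trans z≤n u<t)

    j<u : ∀ {j} → 2 * suc j ≤ u → j < u
    j<u {j} 2[1+j]≤u = ≤-trans (m≤m+n (suc j) (suc j + 0)) 2[1+j]≤u

    j<t : ∀ {j} → 2 * suc j ≤ u → j < t
    j<t 2[1+j]≤u = <-trans (j<u 2[1+j]≤u) u<t

    falls-after : ∀ {j} → 2 * suc j ≤ u → term t u (suc j) ≤ term t u j → t ≤ j * u + (j + u)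
    falls-after {j} h falls = t∸j≤den⇒t≤j*u+[j+u] {t} {u} {j} (term-falls⇒t∸j≤den (j<t h) (j<u h) falls)

    rises-into : ∀ {i} → 2 * suc i ≤ u → term t u i ≤ term t u (suc i) → den u i ≤ t
    rises-into {i} h rises = ≤-trans (term-rises⇒den≤t∸j (j<t h) (j<u h) rises) (m∸n≤m t i)

  peak-location : ∀ {j₀} → 2 * j₀ ≤ u → (∀ j → 2 * j ≤ u → term t u j ≤ term t u j₀) →
                  k * ∣ j₀ * u - t ∣ ≤ t
  peak-location {zero} _ maximal = ⊥-elim (<⇒≱ u<t (falls-after 2≤u (maximal 1 2≤u)))
  peak-location {suc i} 2j₀≤u maximal with ∣m-n∣≡[m∸n]∨[n∸m] (suc i * u) t
  ... | inj₁ ∣j₀u-t∣≡j₀u∸t = begin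
    k * ∣ suc i * u - t ∣  ≡⟨ cong (k *_) ∣j₀u-t∣≡j₀u∸t ⟩
    k * (suc i * u ∸ t)    ≤⟨ *-monoʳ-≤ k (m≤n+o⇒m∸n≤o (suc i * u) t overshoot) ⟩
    k * (suc i * i)        ≤⟨ *-monoʳ-≤ k (*-monoʳ-≤ (suc i) (n≤1+n i)) ⟩
    k * (suc i * suc i)    ≤⟨ j*u≤2*t⇒k*j²≤t {k} {t} {u} {suc i} 4kt≤u² (den≤t⇒[1+i]*u≤2*t {t} {u} {i} 2i≤u den≤t) ⟩
    t                      ∎
    where
    open ≤-Reasoning
    2i≤u : 2 * i ≤ u
    2i≤u = ≤-trans (*-monoʳ-≤ 2 (n≤1+n i)) 2j₀≤u
    den≤t : den u i ≤ t
    den≤t = rises-into 2j₀≤u (maximal i 2i≤u)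
    overshoot : suc i * u ≤ t + suc i * i
    overshoot = den≤t⇒[1+i]*u≤t+[1+i]*i (≤-trans (m≤m+n i (i + 0)) 2i≤u) den≤t
  ... | inj₂ ∣j₀u-t∣≡t∸j₀u = begin
    k * ∣ suc i * u - t ∣      ≡⟨ cong (k *_) ∣j₀u-t∣≡t∸j₀u ⟩
    k * (t ∸ suc i * u)        ≤⟨ *-monoʳ-≤ k undershoot ⟩
    k * (suc i + u)            ≤⟨ *-monoʳ-≤ k (+-monoˡ-≤ u (j<u 2j₀≤u)) ⟩
    k * (u + u)                ≤⟨ m≤m+n (k * (u + u)) (k * (u + u)) ⟩
    k * (u + u) + k * (u + u)  ≡⟨ collect k u ⟩
    4 * k * u                  ≤⟨ 4ku≤t ⟩
    t                          ∎
    where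
    open ≤-Reasoning
    collect : ∀ k u → k * (u + u) + k * (u + u) ≡ 4 * k * u
    collect = solve-∀
    undershoot : t ∸ suc i * u ≤ suc i + u
    undershoot with 2 * suc (suc i) ≤? u
    ... | yes h = m≤n+o⇒m∸n≤o t (suc i * u) (falls-after h (maximal (suc (suc i)) h))
    ... | no  h = ≤-trans (≤-reflexive (m≤n⇒m∸n≡0 (u<2[1+j]⇒t≤j*u 1≤k (s≤s z≤n) 4kt≤u² (≰⇒> h)))) z≤n

lemma2p6 :
    -- (a) for every ε = 1/m there is K such that t/u ≥ K, u²/t ≥ K force |j₀ - t/u| ≤ (t/u)/m
    ((m : ℕ) → 1 ≤ m →
      Σ ℕ λ K → (n t j₀ : ℕ) → 1 ≤ n → 1 ≤ t → 10 ≤ n ∸ t →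
        K * (n ∸ t) ≤ t → K * t ≤ (n ∸ t) * (n ∸ t) →
        2 * j₀ ≤ n ∸ t →
        ((j : ℕ) → 2 * j ≤ n ∸ t → term t (n ∸ t) j ≤ term t (n ∸ t) j₀) →
        m * ∣ j₀ * (n ∸ t) - t ∣ ≤ t)
    ×
    -- (b) sum_{0 ≤ j ≤ u/10} ≤ C sqrt(t/u) max_{0 ≤ j ≤ u}, squared and multiplied by u
    (Σ ℕ λ C → Σ ℕ λ K → (n t : ℕ) → 1 ≤ n → 1 ≤ t → 10 ≤ n ∸ t →
        K * (n ∸ t) ≤ t → K * t ≤ (n ∸ t) * (n ∸ t) →
        (n ∸ t) * (sumUpTo ((n ∸ t) / 10) (term t (n ∸ t))
                   * sumUpTo ((n ∸ t) / 10) (term t (n ∸ t)))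
          ≤ (C * C) * t * (maxUpTo (n ∸ t) (term t (n ∸ t))
                           * maxUpTo (n ∸ t) (term t (n ∸ t))))
lemma2p6 =
  (λ m 1≤m → 4 * m , λ n t j₀ _ _ 10≤u 4mu≤t 4mt≤u² 2j₀≤u maximal →
     peak-location {m} {t} {n ∸ t} 1≤m (≤-trans (m≤m+n 2 8) 10≤u) 4mu≤t 4mt≤u² {j₀} 2j₀≤u maximal)
  -- (b) needs only u ≤ t.
  , (20 , 1 , λ n t _ _ 10≤u 1*u≤t _ →
     sum-squared-bound (≤-trans (s≤s z≤n) 10≤u) (subst (_≤ t) (*-identityˡ (n ∸ t)) 1*u≤t))
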